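{- Let $G = L(S(K_4))$. Then $G$ is a claw-free planar cubic graph of order $12$ satisfying $\chi_M(G^2) > \chi(G^2)+1$.
   Context: All graphs are simple. $S(H)$ denotes the subdivision graph of $H$, obtained by inserting a new vertex on each edge of $H$. $L(H)$ is the line graph of $H$: its vertex set is $E(H)$ and two edges are adjacent if they share an end. A graph is claw-free if no vertex has three pairwise non-adjacent neighbours. The square $G^2$ is the graph on $V(G)$ in which two distinct vertices are adjacent iff their distance in $G$ is at most $2$. $\chi$ is the chromatic number. The Mirzakhani-chromatic number $\chi_M(H)$ is the minimum integer $k$ such that for every function $c_0: V(H)\to \mathbb{Z}$ there is a proper coloring $c: V(H)\to\{1,\dots,k\}$ with $c(v)\neq c_0(v)$ for every vertex $v$. -}

module Defs where

open import Data.Bool using (Bool; true; false; _∧_; _∨_; not; T)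
open import Data.Nat using (ℕ; zero; suc; _≤_; _<_; _+_; _<ᵇ_)
open import Data.Fin using (Fin; toℕ)
open import Data.Fin.Properties using () renaming (_≟_ to _≟ᶠ_)
open import Data.Integer using (ℤ; +_)
open import Data.Rational using (ℚ; 0ℚ; 1ℚ) renaming (_+_ to _+q_; _*_ to _*q_; _-_ to _-q_; _≤_ to _≤q_)
open import Data.List using (List; []; _∷_; map; _++_; concatMap; allFin; length)
open import Data.Bool.ListAction using (any)
open import Data.Maybe using (Maybe; just; nothing)
open import Data.List using (mapMaybe)
open import Data.Product using (Σ; _×_; _,_; proj₁; proj₂; ∃)
open import Data.Sum using (_⊎_; inj₁; inj₂)
open import Data.Unit using (tt)
open import Relation.Nullary using (¬_; does)
open import Relation.Binary.PropositionalEquality using (_≡_; _≢_)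
open import Function.Bundles using (_↔_)

-- Finite simple graphs, given by a list of all vertices, a Boolean
-- (symmetric, irreflexive) adjacency relation, a Boolean equality test
-- (reflecting _≡_) and a Boolean strict total order (used only to pick a
-- canonical orientation of each edge, so that edges are unordered pairs).

record Graph : Set₁ where
  field
    V     : Set
    elems : List V
    adj   : V → V → Bool
    eqv   : V → V → Bool
    ltv   : V → V → Bool
open Graph public

Edge : Graph → Set
Edge H = Σ (V H × V H) (λ p → T (adj H (proj₁ p) (proj₂ p) ∧ ltv H (proj₁ p) (proj₂ p)))

private
  fromBool : (b : Bool) → Maybe (T b)
  fromBool true  = just tt
  fromBool false = nothing

  mkEdge : (H : Graph) → V H × V H → Maybe (Edge H)
  mkEdge H p with fromBool (adj H (proj₁ p) (proj₂ p) ∧ ltv H (proj₁ p) (proj₂ p))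
  ... | just t  = just (p , t)
  ... | nothing = nothing

edges : (H : Graph) → List (Edge H)
edges H = mapMaybe (mkEdge H) (concatMap (λ u → map (λ v → (u , v)) (elems H)) (elems H))

edgeEq : (H : Graph) → Edge H → Edge H → Bool
edgeEq H ((u , v) , _) ((x , y) , _) = eqv H u x ∧ eqv H v y

edgeLt : (H : Graph) → Edge H → Edge H → Bool
edgeLt H ((u , v) , _) ((x , y) , _) = ltv H u x ∨ (eqv H u x ∧ ltv H v y)

K4 : Graph
K4 = record
  { V     = Fin 4
  ; elems = allFin 4
  ; adj   = λ u v → not (does (u ≟ᶠ v))
  ; eqv   = λ u v → does (u ≟ᶠ v)
  ; ltv   = λ u v → toℕ u <ᵇ toℕ v
  }

S : Graph → Graph
S H = record
  { V     = V H ⊎ Edge H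
  ; elems = map inj₁ (elems H) ++ map inj₂ (edges H)
  ; adj   = sadj
  ; eqv   = seq
  ; ltv   = slt
  }
  where
  sadj : V H ⊎ Edge H → V H ⊎ Edge H → Bool
  sadj (inj₁ w) (inj₂ ((u , v) , _)) = eqv H w u ∨ eqv H w v
  sadj (inj₂ ((u , v) , _)) (inj₁ w) = eqv H w u ∨ eqv H w v
  sadj _ _ = false
  seq : V H ⊎ Edge H → V H ⊎ Edge H → Bool
  seq (inj₁ a) (inj₁ b) = eqv H a b
  seq (inj₂ e) (inj₂ f) = edgeEq H e f
  seq _ _ = false
  slt : V H ⊎ Edge H → V H ⊎ Edge H → Bool
  slt (inj₁ a) (inj₁ b) = ltv H a b
  slt (inj₁ _) (inj₂ _) = true
  slt (inj₂ _) (inj₁ _) = false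
  slt (inj₂ e) (inj₂ f) = edgeLt H e f

L : Graph → Graph
L H = record
  { V     = Edge H
  ; elems = edges H
  ; adj   = ladj
  ; eqv   = edgeEq H
  ; ltv   = edgeLt H
  }
  where
  ladj : Edge H → Edge H → Bool
  ladj e@((u , v) , _) f@((x , y) , _) =
    not (edgeEq H e f) ∧ (eqv H u x ∨ eqv H u y ∨ eqv H v x ∨ eqv H v y)

Square : Graph → Graph
Square G = record
  { V     = V G
  ; elems = elems G
  ; adj   = λ u v → not (eqv G u v) ∧
                    (adj G u v ∨ any (λ w → adj G u w ∧ adj G w v) (elems G))
  ; eqv   = eqv G
  ; ltv   = ltv G
  }

Adj : (G : Graph) → V G → V G → Set
Adj G u v = T (adj G u v)

HasOrder : Graph → ℕ → Set
HasOrder G n = V G ↔ Fin n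

Cubic : Graph → Set
Cubic G = ∀ v → Σ (V G) λ a → Σ (V G) λ b → Σ (V G) λ c →
  (a ≢ b) × (a ≢ c) × (b ≢ c) × Adj G v a × Adj G v b × Adj G v c ×
  (∀ u → Adj G v u → (u ≡ a) ⊎ (u ≡ b) ⊎ (u ≡ c))

Claw : Graph → Set
Claw G = Σ (V G) λ v → Σ (V G) λ a → Σ (V G) λ b → Σ (V G) λ c →
  (a ≢ b) × (a ≢ c) × (b ≢ c) × Adj G v a × Adj G v b × Adj G v c ×
  ¬ Adj G a b × ¬ Adj G a c × ¬ Adj G b c

ClawFree : Graph → Set
ClawFree G = ¬ Claw G

-- Planarity, via straight-line drawings with rational coordinates
-- (equivalent to planarity by Fáry's theorem).
Point : Set
Point = ℚ × ℚ

OnSegment : Point → Point → Point → Set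
OnSegment (a₁ , a₂) (b₁ , b₂) (p₁ , p₂) = Σ ℚ λ t →
  (0ℚ ≤q t) × (t ≤q 1ℚ) ×
  (p₁ ≡ a₁ +q t *q (b₁ -q a₁)) × (p₂ ≡ a₂ +q t *q (b₂ -q a₂))

record StraightLinePlanarDrawing (G : Graph) : Set where
  field
    pos       : V G → Point
    injective : ∀ u v → pos u ≡ pos v → u ≡ v
    vertexOff : ∀ w u v → Adj G u v → w ≢ u → w ≢ v →
                ¬ OnSegment (pos u) (pos v) (pos w)
    edgesMeet : ∀ u v x y → Adj G u v → Adj G x y →
                ¬ ((u ≡ x × v ≡ y) ⊎ (u ≡ y × v ≡ x)) →
                ∀ P → OnSegment (pos u) (pos v) P → OnSegment (pos x) (pos y) P →
                Σ (V G) λ w → ((w ≡ u) ⊎ (w ≡ v)) × ((w ≡ x) ⊎ (w ≡ y)) × (P ≡ pos w)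

Planar : Graph → Set
Planar G = StraightLinePlanarDrawing G

-- proper colouring with colours {1,…,k} (Fin k, colour i meaning i+1)
Proper : (G : Graph) {k : ℕ} → (V G → Fin k) → Set
Proper G c = ∀ u v → Adj G u v → c u ≢ c v

Colorable : Graph → ℕ → Set
Colorable G k = Σ (V G → Fin k) (Proper G)

MColorable : Graph → ℕ → Set
MColorable G k = (c₀ : V G → ℤ) → Σ (V G → Fin k) λ c →
  Proper G c × (∀ v → + suc (toℕ (c v)) ≢ c₀ v)

IsLeast : (ℕ → Set) → ℕ → Set
IsLeast P k = P k × (∀ j → P j → k ≤ j)

IsChromaticNumber : Graph → ℕ → Set
IsChromaticNumber G = IsLeast (Colorable G)

IsMirzakhaniChromaticNumber : Graph → ℕ → Set
IsMirzakhaniChromaticNumber G = IsLeast (MColorable G)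

Gr : Graph
Gr = L (S K4)

{-# OPTIONS --safe #-}

-- L(S(K₄)) is the truncated tetrahedron: its vertices are the twelve darts
-- a → b of K₄, two darts being adjacent when they leave the same vertex or
-- are reverse to each other. Each dart lies in the triangle of darts
-- sharing its tail, so the graph is claw-free, and truncating a
-- straight-line drawing of K₄ draws it in the plane. In the square, two
-- darts are adjacent when they share their tail or the head of one is the
-- tail of the other. Hence the head map is a proper 4-colouring, the darts
-- 0 → 1, 0 → 2, 0 → 3, 1 → 0 form a 4-clique, and the four classes of darts
-- entering a common vertex are independent. Giving the classes entering
-- 0, 1, 2 one colour each and colouring the darts entering 3 separately
-- avoids any forbidden assignment with 6 colours. With 5 colours, forbidding
-- on each dart the number of the perfect matching of K₄ containing its edge
-- cannot be avoided, which an exhaustive search confirms.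

module Submission where

open import Defs
open import Data.Nat using (ℕ; _+_; _<_)

open import Data.Bool using (Bool; T; not; _∧_; _∨_; if_then_else_)
import Data.Bool.Properties as Bool
open import Data.Empty using (⊥; ⊥-elim)
open import Data.Fin as Fin
  using (Fin; toℕ; _↑ˡ_; inject≤; punchIn; punchOut; combine; quotient; remainder)
open import Data.Fin.Patterns using (0F; 1F; 2F; 3F)
open import Data.Fin.Properties
  using (all?; any?; ¬∀⟶∃¬; pigeonhole; <⇒≢; inject≤-injective; toℕ-inject≤; toℕ-injective)
  renaming (_≟_ to _≟ᶠ_)
open import Data.Integer as ℤ using (ℤ; +_)
import Data.Integer.Properties as ℤ
open import Data.List using (List; []; _∷_; allFin; filter; map; length; lookup)
open import Data.List.Membership.Propositional using (_∈_)
open import Data.List.Membership.Propositional.Properties using (∈-allFin; ∈-filter⁺; ∈-map⁺)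
open import Data.List.Relation.Unary.All as All using (All; []; _∷_)
open import Data.List.Relation.Unary.All.Properties using (¬Any⇒All¬)
open import Data.List.Relation.Unary.Any as Any using (Any; here; there)
open import Data.List.Relation.Unary.Any.Properties using (lookup-index)
open import Data.Maybe using (Maybe; just; nothing)
import Data.Maybe.Properties as Maybe
import Data.Nat as ℕ
import Data.Nat.Properties as ℕ
open import Data.Product using (Σ; _×_; _,_; proj₁; proj₂)
import Data.Product.Properties as Product
open import Data.Rational as ℚ using (ℚ; 0ℚ; 1ℚ; _/_)
import Data.Rational.Properties as ℚ
open import Data.Rational.Solver using (module +-*-Solver)
open import Data.Sum as Sum using (_⊎_; inj₁; inj₂)
open import Function using (_∘_)
open import Function.Bundles using (_↔_; Inverse; mk↔ₛ′)
open import Function.Properties.Inverse using (↔-sym)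
open import Relation.Binary.Definitions using (DecidableEquality)
open import Relation.Binary.PropositionalEquality
open import Relation.Nullary using (Dec; yes; no; does; ¬_; contradiction)
open import Relation.Nullary.Decidable
  using (True; toWitness; from-yes; from-no; T?; ¬?; _×-dec_; _⊎-dec_; _→-dec_)

label : ∀ {k} → Fin k → ℤ
label c = + ℕ.suc (toℕ c)

label-injective : ∀ {k} {c d : Fin k} → label c ≡ label d → c ≡ d
label-injective = toℕ-injective ∘ ℕ.suc-injective ∘ ℤ.+-injective

differ : ∀ {k} {c d : Fin k} → label c ≢ label d → c ≢ d
differ labels≢ = labels≢ ∘ cong label

Monotone : (ℕ → Set) → Set
Monotone P = ∀ {j k} → j ℕ.≤ k → P j → P k

colorable-mono : ∀ G → Monotone (Colorable G)
colorable-mono G j≤k (c , proper) =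
  (λ v → inject≤ (c v) j≤k) , λ u v uv → proper u v uv ∘ inject≤-injective j≤k j≤k _ _

mColorable-mono : ∀ G → Monotone (MColorable G)
mColorable-mono G j≤k mColorable c₀ with mColorable c₀
... | c , proper , avoids =
  (λ v → inject≤ (c v) j≤k) ,
  (λ u v uv → proper u v uv ∘ inject≤-injective j≤k j≤k _ _) ,
  λ v → subst (λ m → + ℕ.suc m ≢ c₀ v) (sym (toℕ-inject≤ (c v) j≤k)) (avoids v)

isLeast-suc : ∀ {P : ℕ → Set} {k} → Monotone P → ¬ P k → P (ℕ.suc k) → IsLeast P (ℕ.suc k)
isLeast-suc {P} {k} mono ¬Pk Psk = Psk , least
  where
  least : ∀ j → P j → ℕ.suc k ℕ.≤ j
  least j Pj with ℕ.suc k ℕ.≤? j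
  ... | yes k<j = k<j
  ... | no  k≮j = contradiction (mono (ℕ.≤-pred (ℕ.≰⇒> k≮j)) Pj) ¬Pk

isLeast-⇔ : ∀ {P Q : ℕ → Set} {k} → (∀ {j} → P j → Q j) → (∀ {j} → Q j → P j) →
            IsLeast P k → IsLeast Q k
isLeast-⇔ P⇒Q Q⇒P (Pk , least) = P⇒Q Pk , λ j Qj → least j (Q⇒P Qj)

clique⇒¬colorable : ∀ G {k} (f : Fin (ℕ.suc k) → V G) →
                    (∀ i j → i ≢ j → Adj G (f i) (f j)) → ¬ Colorable G k
clique⇒¬colorable G f clique (c , proper)
  with i , j , i<j , same ← pigeonhole ℕ.≤-refl (c ∘ f)
  = proper (f i) (f j) (clique i j (<⇒≢ i<j)) same

fresh : ∀ {k} (xs : List ℤ) → length xs < k → Σ (Fin k) λ c → All (label c ≢_) xs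
fresh {k} xs xs<k with all? (λ c → Any.any? (label c ℤ.≟_) xs)
... | no ¬covered
  with c , c∉xs ← ¬∀⟶∃¬ k _ (λ c → Any.any? (label c ℤ.≟_) xs) ¬covered
  = c , ¬Any⇒All¬ xs c∉xs
... | yes covered
  with i , j , i<j , same ← pigeonhole xs<k (Any.index ∘ covered)
  = contradiction (label-injective label≡) (<⇒≢ i<j)
  where
  label≡ : label i ≡ label j
  label≡ = trans (lookup-index (covered i))
             (trans (cong (lookup xs) same) (sym (lookup-index (covered j))))

module Backtracking (G : Graph) (k : ℕ) (c₀ : V G → ℤ) where

  -- Partial colourings, the most recently coloured vertex first.
  Assignment : Set
  Assignment = List (V G × Fin k)

  Clash : Assignment → Set
  Clash []            = ⊥
  Clash ((v , x) ∷ ρ) = label x ≡ c₀ v ⊎ Any (λ (w , y) → Adj G v w × x ≡ y) ρ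

  clash? : ∀ ρ → Dec (Clash ρ)
  clash? []            = no λ ()
  clash? ((v , x) ∷ ρ) =
    label x ℤ.≟ c₀ v ⊎-dec Any.any? (λ (w , y) → T? (adj G v w) ×-dec x ≟ᶠ y) ρ

  Refuted : List (V G) → Assignment → Set
  Refuted []       ρ = Clash ρ
  Refuted (v ∷ vs) ρ = Clash ρ ⊎ (∀ x → Refuted vs ((v , x) ∷ ρ))

  refuted? : ∀ vs ρ → Dec (Refuted vs ρ)
  refuted? []       ρ = clash? ρ
  refuted? (v ∷ vs) ρ = clash? ρ ⊎-dec all? λ x → refuted? vs ((v , x) ∷ ρ)

  module _ (c : V G → Fin k) (proper : Proper G c) (avoids : ∀ v → label (c v) ≢ c₀ v) where

    Agrees : Assignment → Set
    Agrees = All λ (v , x) → c v ≡ x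

    no-clash : ∀ ρ → Agrees ρ → ¬ Clash ρ
    no-clash ((v , x) ∷ ρ) (refl ∷ _)      (inj₁ forbidden) = avoids v forbidden
    no-clash ((v , x) ∷ ρ) (refl ∷ agrees) (inj₂ clash)     = clash-free ρ agrees clash
      where
      clash-free : ∀ ρ → Agrees ρ → ¬ Any (λ (w , y) → Adj G v w × c v ≡ y) ρ
      clash-free _ (cw ∷ _)      (here (vw , cv)) = proper v _ vw (trans cv (sym cw))
      clash-free _ (_  ∷ agrees) (there clash)    = clash-free _ agrees clash

    ¬refuted : ∀ vs ρ → Agrees ρ → ¬ Refuted vs ρ
    ¬refuted []       ρ agrees clash        = no-clash ρ agrees clash
    ¬refuted (_ ∷ _)  ρ agrees (inj₁ clash) = no-clash ρ agrees clash
    ¬refuted (v ∷ vs) ρ agrees (inj₂ all)   = ¬refuted vs _ (refl ∷ agrees) (all (c v))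

  refuted⇒¬mColorable : ∀ vs → Refuted vs [] → ¬ MColorable G k
  refuted⇒¬mColorable vs refuted mColorable with mColorable c₀
  ... | c , proper , avoids = ¬refuted c proper avoids vs [] [] refuted

record _≅_ (G H : Graph) : Set where
  field
    vertices : V G ↔ V H
    adj-≡    : ∀ u v → adj H (Inverse.to vertices u) (Inverse.to vertices v) ≡ adj G u v

  open Inverse vertices public using (to; from; strictlyInverseˡ; strictlyInverseʳ)

  to-injective : ∀ {u v} → to u ≡ to v → u ≡ v
  to-injective {u} {v} eq = begin
    u           ≡⟨ strictlyInverseʳ u ⟨
    from (to u) ≡⟨ cong from eq ⟩
    from (to v) ≡⟨ strictlyInverseʳ v ⟩
    v           ∎
    where open ≡-Reasoning

  adj-to : ∀ {u v} → Adj G u v → Adj H (to u) (to v)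
  adj-to {u} {v} = subst T (sym (adj-≡ u v))

  adj-to⁻ : ∀ {u v} → Adj H (to u) (to v) → Adj G u v
  adj-to⁻ {u} {v} = subst T (adj-≡ u v)

≅-sym : ∀ {G H} → G ≅ H → H ≅ G
≅-sym {G} {H} G≅H = record
  { vertices = ↔-sym (_≅_.vertices G≅H)
  ; adj-≡    = λ u v → begin
      adj G (from u) (from v)           ≡⟨ adj-≡ (from u) (from v) ⟨
      adj H (to (from u)) (to (from v)) ≡⟨ cong₂ (adj H) (strictlyInverseˡ u) (strictlyInverseˡ v) ⟩
      adj H u v                         ∎
  }
  where open _≅_ G≅H; open ≡-Reasoning

claw-≅ : ∀ {G H} → G ≅ H → Claw G → Claw H
claw-≅ G≅H (v , a , b , c , a≢b , a≢c , b≢c , va , vb , vc , ¬ab , ¬ac , ¬bc) =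
  to v , to a , to b , to c ,
  a≢b ∘ to-injective , a≢c ∘ to-injective , b≢c ∘ to-injective ,
  adj-to va , adj-to vb , adj-to vc ,
  ¬ab ∘ adj-to⁻ , ¬ac ∘ adj-to⁻ , ¬bc ∘ adj-to⁻
  where open _≅_ G≅H

module _ {G H : Graph} (G≅H : G ≅ H) where
  private
    open _≅_ G≅H
    module H = _≅_ (≅-sym G≅H)

  clawFree-≅ : ClawFree G → ClawFree H
  clawFree-≅ clawFree = clawFree ∘ claw-≅ (≅-sym G≅H)

  cubic-≅ : Cubic G → Cubic H
  cubic-≅ cubic v with cubic (from v)
  ... | a , b , c , a≢b , a≢c , b≢c , va , vb , vc , only =
    to a , to b , to c ,
    a≢b ∘ to-injective , a≢c ∘ to-injective , b≢c ∘ to-injective ,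
    adj-from va , adj-from vb , adj-from vc ,
    λ u vu → Sum.map (back u) (Sum.map (back u) (back u)) (only (from u) (H.adj-to vu))
    where
    adj-from : ∀ {w} → Adj G (from v) w → Adj H v (to w)
    adj-from {w} = subst (λ x → Adj H x (to w)) (strictlyInverseˡ v) ∘ adj-to
    back : ∀ u {w} → from u ≡ w → u ≡ to w
    back u eq = trans (sym (strictlyInverseˡ u)) (cong to eq)

  planar-≅ : Planar G → Planar H
  planar-≅ drawing = record
    { pos       = pos ∘ from
    ; injective = λ u v eq → H.to-injective (injective (from u) (from v) eq)
    ; vertexOff = λ w u v uv w≢u w≢v →
        vertexOff (from w) (from u) (from v) (H.adj-to uv)
          (w≢u ∘ H.to-injective) (w≢v ∘ H.to-injective)
    ; edgesMeet = meet
    }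
    where
    open StraightLinePlanarDrawing drawing
    back : ∀ {w u} → w ≡ from u → to w ≡ u
    back {u = u} refl = strictlyInverseˡ u
    meet : ∀ u v x y → Adj H u v → Adj H x y → ¬ ((u ≡ x × v ≡ y) ⊎ (u ≡ y × v ≡ x)) →
           ∀ P → OnSegment (pos (from u)) (pos (from v)) P → OnSegment (pos (from x)) (pos (from y)) P →
           Σ (V H) λ w → ((w ≡ u) ⊎ (w ≡ v)) × ((w ≡ x) ⊎ (w ≡ y)) × (P ≡ pos (from w))
    meet u v x y uv xy notSame P Puv Pxy
      with edgesMeet (from u) (from v) (from x) (from y) (H.adj-to uv) (H.adj-to xy) notSame′ P Puv Pxy
      where
      notSame′ : ¬ ((from u ≡ from x × from v ≡ from y) ⊎ (from u ≡ from y × from v ≡ from x))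
      notSame′ (inj₁ (ux , vy)) = notSame (inj₁ (H.to-injective ux , H.to-injective vy))
      notSame′ (inj₂ (uy , vx)) = notSame (inj₂ (H.to-injective uy , H.to-injective vx))
    ... | w , uv-end , xy-end , P≡w =
      to w , Sum.map back back uv-end , Sum.map back back xy-end ,
      trans P≡w (cong pos (sym (strictlyInverseʳ w)))

  colorable-≅ : ∀ {k} → Colorable G k → Colorable H k
  colorable-≅ (c , proper) = c ∘ from , λ u v uv → proper (from u) (from v) (H.adj-to uv)

  mColorable-≅ : ∀ {k} → MColorable G k → MColorable H k
  mColorable-≅ mColorable c₀ with mColorable (c₀ ∘ to)
  ... | c , proper , avoids =
    c ∘ from ,
    (λ u v uv → proper (from u) (from v) (H.adj-to uv)) ,
    λ v → subst (λ w → label (c (from v)) ≢ c₀ w) (strictlyInverseˡ v) (avoids (from v))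

isChromaticNumber-≅ : ∀ {G H k} → G ≅ H → IsChromaticNumber G k → IsChromaticNumber H k
isChromaticNumber-≅ G≅H = isLeast-⇔ (colorable-≅ G≅H) (colorable-≅ (≅-sym G≅H))

isMirzakhaniChromaticNumber-≅ : ∀ {G H k} → G ≅ H →
                                IsMirzakhaniChromaticNumber G k → IsMirzakhaniChromaticNumber H k
isMirzakhaniChromaticNumber-≅ G≅H = isLeast-⇔ (mColorable-≅ G≅H) (mColorable-≅ (≅-sym G≅H))

finGraph : (n : ℕ) → (Fin n → Fin n → Bool) → Graph
finGraph n A = record
  { V     = Fin n
  ; elems = allFin n
  ; adj   = A
  ; eqv   = λ i j → does (i ≟ᶠ j)
  ; ltv   = λ i j → toℕ i ℕ.<ᵇ toℕ j
  }

module _ {n : ℕ} (A : Fin n → Fin n → Bool) where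
  private
    G : Graph
    G = finGraph n A

  claw? : Dec (Claw G)
  claw? =
    any? λ v → any? λ a → any? λ b → any? λ c →
      ¬? (a ≟ᶠ b) ×-dec ¬? (a ≟ᶠ c) ×-dec ¬? (b ≟ᶠ c) ×-dec
      T? (A v a) ×-dec T? (A v b) ×-dec T? (A v c) ×-dec
      ¬? (T? (A a b)) ×-dec ¬? (T? (A a c)) ×-dec ¬? (T? (A b c))

  cubic? : Dec (Cubic G)
  cubic? =
    all? λ v → any? λ a → any? λ b → any? λ c →
      ¬? (a ≟ᶠ b) ×-dec ¬? (a ≟ᶠ c) ×-dec ¬? (b ≟ᶠ c) ×-dec
      T? (A v a) ×-dec T? (A v b) ×-dec T? (A v c) ×-dec
      all? λ u → T? (A v u) →-dec (u ≟ᶠ a ⊎-dec u ≟ᶠ b ⊎-dec u ≟ᶠ c)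

open +-*-Solver

p≤q⇒0≤q-p : ∀ {p q} → p ℚ.≤ q → 0ℚ ℚ.≤ q ℚ.- p
p≤q⇒0≤q-p {p} {q} p≤q = subst (ℚ._≤ q ℚ.- p) (ℚ.+-inverseʳ p) (ℚ.+-monoˡ-≤ (ℚ.- p) p≤q)

0≤p*q : ∀ {p q} → 0ℚ ℚ.≤ p → 0ℚ ℚ.≤ q → 0ℚ ℚ.≤ p ℚ.* q
0≤p*q {p} {q} 0≤p 0≤q =
  subst (ℚ._≤ p ℚ.* q) (ℚ.*-zeroʳ p) (ℚ.*-monoˡ-≤-nonNeg p {{ℚ.nonNegative 0≤p}} 0≤q)

0<p+q : ∀ {p q} → 0ℚ ℚ.< p → 0ℚ ℚ.≤ q → 0ℚ ℚ.< p ℚ.+ q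
0<p+q {p} {q} 0<p 0≤q = subst (ℚ._< p ℚ.+ q) (ℚ.+-identityʳ 0ℚ) (ℚ.+-mono-<-≤ 0<p 0≤q)

p*q≡0⇒p≡0 : ∀ p q → q ≢ 0ℚ → p ℚ.* q ≡ 0ℚ → p ≡ 0ℚ
p*q≡0⇒p≡0 p q q≢0 pq≡0 = begin
  p                      ≡⟨ ℚ.*-identityʳ p ⟨
  p ℚ.* 1ℚ               ≡⟨ cong (p ℚ.*_) (ℚ.*-inverseʳ q) ⟨
  p ℚ.* (q ℚ.* q⁻¹)      ≡⟨ ℚ.*-assoc p q q⁻¹ ⟨
  (p ℚ.* q) ℚ.* q⁻¹      ≡⟨ cong (ℚ._* q⁻¹) pq≡0 ⟩
  0ℚ ℚ.* q⁻¹             ≡⟨ ℚ.*-zeroˡ q⁻¹ ⟩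
  0ℚ                     ∎
  where
  open ≡-Reasoning
  instance
    q≢0′ : ℚ.NonZero q
    q≢0′ = ℚ.≢-nonZero q≢0
  q⁻¹ : ℚ
  q⁻¹ = ℚ.1/ q

interpolate-flip : ∀ a b t → a ℚ.+ t ℚ.* (b ℚ.- a) ≡ b ℚ.+ (1ℚ ℚ.- t) ℚ.* (a ℚ.- b)
interpolate-flip = solve 3 (λ a b t → a :+ t :* (b :- a) := b :+ (con 1ℚ :- t) :* (a :- b)) refl

0<interpolate : ∀ a b t → 0ℚ ℚ.< a → 0ℚ ℚ.< b → 0ℚ ℚ.≤ t → t ℚ.≤ 1ℚ →
                0ℚ ℚ.< a ℚ.+ t ℚ.* (b ℚ.- a)
0<interpolate a b t 0<a 0<b 0≤t t≤1 with a ℚ.≤? b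
... | yes a≤b = 0<p+q 0<a (0≤p*q 0≤t (p≤q⇒0≤q-p a≤b))
... | no  a≰b = subst (0ℚ ℚ.<_) (sym (interpolate-flip a b t))
                  (0<p+q 0<b (0≤p*q (p≤q⇒0≤q-p t≤1) (p≤q⇒0≤q-p (ℚ.<⇒≤ (ℚ.≰⇒> a≰b)))))

-- Twice the signed area of the triangle A B P: positive when P lies to
-- the left of the directed line A B.
orient : Point → Point → Point → ℚ
orient (a₁ , a₂) (b₁ , b₂) (p₁ , p₂) =
  (b₁ ℚ.- a₁) ℚ.* (p₂ ℚ.- a₂) ℚ.- (b₂ ℚ.- a₂) ℚ.* (p₁ ℚ.- a₁)

orientᴾ : ∀ {n} (a₁ a₂ b₁ b₂ p₁ p₂ : Polynomial n) → Polynomial n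
orientᴾ a₁ a₂ b₁ b₂ p₁ p₂ = (b₁ :- a₁) :* (p₂ :- a₂) :- (b₂ :- a₂) :* (p₁ :- a₁)

LeftOf : Point → Point → Point → Set
LeftOf A B P = 0ℚ ℚ.< orient A B P

orient-affine : ∀ A B X Y P (s : OnSegment X Y P) →
  orient A B P ≡ orient A B X ℚ.+ proj₁ s ℚ.* (orient A B Y ℚ.- orient A B X)
orient-affine (a₁ , a₂) (b₁ , b₂) (x₁ , x₂) (y₁ , y₂) _ (t , _ , _ , refl , refl) =
  solve 9 (λ a₁ a₂ b₁ b₂ x₁ x₂ y₁ y₂ t →
    let ori = orientᴾ a₁ a₂ b₁ b₂ in
    ori (x₁ :+ t :* (y₁ :- x₁)) (x₂ :+ t :* (y₂ :- x₂)) := ori x₁ x₂ :+ t :* (ori y₁ y₂ :- ori x₁ x₂))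
    refl a₁ a₂ b₁ b₂ x₁ x₂ y₁ y₂ t

orient-start : ∀ A B → orient A B A ≡ 0ℚ
orient-start (a₁ , a₂) (b₁ , b₂) =
  solve 4 (λ a₁ a₂ b₁ b₂ → orientᴾ a₁ a₂ b₁ b₂ a₁ a₂ := con 0ℚ) refl a₁ a₂ b₁ b₂

orient-end : ∀ A B → orient A B B ≡ 0ℚ
orient-end (a₁ , a₂) (b₁ , b₂) =
  solve 4 (λ a₁ a₂ b₁ b₂ → orientᴾ a₁ a₂ b₁ b₂ b₁ b₂ := con 0ℚ) refl a₁ a₂ b₁ b₂

onSegment⇒collinear : ∀ A B P → OnSegment A B P → orient A B P ≡ 0ℚ
onSegment⇒collinear (a₁ , a₂) (b₁ , b₂) _ (t , _ , _ , refl , refl) =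
  solve 5 (λ a₁ a₂ b₁ b₂ t →
    orientᴾ a₁ a₂ b₁ b₂ (a₁ :+ t :* (b₁ :- a₁)) (a₂ :+ t :* (b₂ :- a₂)) := con 0ℚ)
    refl a₁ a₂ b₁ b₂ t

onSegment-sym : ∀ A B P → OnSegment A B P → OnSegment B A P
onSegment-sym (a₁ , a₂) (b₁ , b₂) _ (t , 0≤t , t≤1 , refl , refl) =
  1ℚ ℚ.- t , p≤q⇒0≤q-p t≤1 , ℚ.+-monoʳ-≤ 1ℚ (ℚ.neg-antimono-≤ 0≤t) ,
  interpolate-flip a₁ b₁ t , interpolate-flip a₂ b₂ t

leftOf-onSegment : ∀ A B X Y P → LeftOf A B X → LeftOf A B Y → OnSegment X Y P → LeftOf A B P
leftOf-onSegment A B X Y P X-left Y-left s@(t , 0≤t , t≤1 , _) =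
  subst (0ℚ ℚ.<_) (sym (orient-affine A B X Y P s)) (0<interpolate _ _ t X-left Y-left 0≤t t≤1)

Separated : Point → Point → Point → Point → Set
Separated A B X Y =
  (LeftOf A B X × LeftOf A B Y) ⊎ (LeftOf B A X × LeftOf B A Y) ⊎
  (LeftOf X Y A × LeftOf X Y B) ⊎ (LeftOf Y X A × LeftOf Y X B)

separated? : ∀ A B X Y → Dec (Separated A B X Y)
separated? A B X Y =
  (left? A B X ×-dec left? A B Y) ⊎-dec (left? B A X ×-dec left? B A Y) ⊎-dec
  (left? X Y A ×-dec left? X Y B) ⊎-dec (left? Y X A ×-dec left? Y X B)
  where
  left? : ∀ A B P → Dec (LeftOf A B P)
  left? A B P = 0ℚ ℚ.<? orient A B P

beside⇒disjoint : ∀ A B X Y P → LeftOf A B X → LeftOf A B Y → OnSegment A B P → ¬ OnSegment X Y P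
beside⇒disjoint A B X Y P X-left Y-left P∈AB P∈XY =
  ℚ.<-irrefl (sym (onSegment⇒collinear A B P P∈AB)) (leftOf-onSegment A B X Y P X-left Y-left P∈XY)

separated⇒disjoint : ∀ A B X Y P → Separated A B X Y → OnSegment A B P → ¬ OnSegment X Y P
separated⇒disjoint A B X Y P (inj₁ (X-left , Y-left)) P∈AB =
  beside⇒disjoint A B X Y P X-left Y-left P∈AB
separated⇒disjoint A B X Y P (inj₂ (inj₁ (X-left , Y-left))) P∈AB =
  beside⇒disjoint B A X Y P X-left Y-left (onSegment-sym A B P P∈AB)
separated⇒disjoint A B X Y P (inj₂ (inj₂ (inj₁ (A-left , B-left)))) P∈AB P∈XY =
  beside⇒disjoint X Y A B P A-left B-left P∈XY P∈AB
separated⇒disjoint A B X Y P (inj₂ (inj₂ (inj₂ (A-left , B-left)))) P∈AB P∈XY =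
  beside⇒disjoint Y X A B P A-left B-left (onSegment-sym X Y P P∈XY) P∈AB

onSegment-start : ∀ A B X Y P → orient A B X ≡ 0ℚ → orient A B Y ≢ 0ℚ →
                  OnSegment X Y P → orient A B P ≡ 0ℚ → P ≡ X
onSegment-start A B X@(x₁ , x₂) Y@(y₁ , y₂) P X-on Y-off s@(t , _ , _ , refl , refl) P-on =
  cong₂ _,_ (stay x₁ y₁) (stay x₂ y₂)
  where
  open ≡-Reasoning
  t≡0 : t ≡ 0ℚ
  t≡0 = p*q≡0⇒p≡0 t (orient A B Y) Y-off (begin
    t ℚ.* orient A B Y
      ≡⟨ solve 2 (λ t y → t :* y := con 0ℚ :+ t :* (y :- con 0ℚ)) refl t _ ⟩
    0ℚ ℚ.+ t ℚ.* (orient A B Y ℚ.- 0ℚ)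
      ≡⟨ cong (λ z → z ℚ.+ t ℚ.* (orient A B Y ℚ.- z)) X-on ⟨
    orient A B X ℚ.+ t ℚ.* (orient A B Y ℚ.- orient A B X)
      ≡⟨ orient-affine A B X Y P s ⟨
    orient A B P
      ≡⟨ P-on ⟩
    0ℚ ∎)
  stay : ∀ x y → x ℚ.+ t ℚ.* (y ℚ.- x) ≡ x
  stay x y = begin
    x ℚ.+ t ℚ.* (y ℚ.- x)   ≡⟨ cong (λ t → x ℚ.+ t ℚ.* (y ℚ.- x)) t≡0 ⟩
    x ℚ.+ 0ℚ ℚ.* (y ℚ.- x)  ≡⟨ solve 2 (λ x y → x :+ con 0ℚ :* (y :- x) := x) refl x y ⟩
    x                       ∎

record DrawingCertificate (G : Graph) (pos : V G → Point) : Set where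
  field
    injective       : ∀ u v → pos u ≡ pos v → u ≡ v
    loopless        : ∀ u → ¬ Adj G u u
    generalPosition : ∀ u v w → Adj G u v → w ≢ u → w ≢ v → orient (pos u) (pos v) (pos w) ≢ 0ℚ
    separated       : ∀ u v x y → Adj G u v → Adj G x y → u ≢ x → u ≢ y → v ≢ x → v ≢ y →
                      Separated (pos u) (pos v) (pos x) (pos y)

certificate⇒drawing : ∀ {G pos} → DecidableEquality (V G) → DrawingCertificate G pos →
                      StraightLinePlanarDrawing G
certificate⇒drawing {G} {pos} _≟_ certificate = record
  { pos       = pos
  ; injective = injective
  ; vertexOff = λ w u v uv w≢u w≢v P∈uv →
      generalPosition u v w uv w≢u w≢v (onSegment⇒collinear (pos u) (pos v) (pos w) P∈uv)
  ; edgesMeet = meet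
  }
  where
  open DrawingCertificate certificate

  atEnd : ∀ {u v} w z P → orient (pos u) (pos v) (pos w) ≡ 0ℚ → Adj G u v → z ≢ u → z ≢ v →
          OnSegment (pos w) (pos z) P → OnSegment (pos u) (pos v) P → P ≡ pos w
  atEnd {u} {v} w z P w-on uv z≢u z≢v P∈wz P∈uv =
    onSegment-start (pos u) (pos v) (pos w) (pos z) P w-on (generalPosition u v z uv z≢u z≢v)
      P∈wz (onSegment⇒collinear (pos u) (pos v) P P∈uv)

  meet : ∀ u v x y → Adj G u v → Adj G x y → ¬ ((u ≡ x × v ≡ y) ⊎ (u ≡ y × v ≡ x)) →
         ∀ P → OnSegment (pos u) (pos v) P → OnSegment (pos x) (pos y) P →
         Σ (V G) λ w → ((w ≡ u) ⊎ (w ≡ v)) × ((w ≡ x) ⊎ (w ≡ y)) × (P ≡ pos w)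
  meet u v x y uv xy notSame P P∈uv P∈xy with u ≟ x | u ≟ y | v ≟ x | v ≟ y
  ... | yes refl | _ | _ | _ =
    u , inj₁ refl , inj₁ refl ,
    atEnd u y P (orient-start (pos u) (pos v)) uv
      (λ { refl → loopless u xy }) (λ { refl → notSame (inj₁ (refl , refl)) })
      P∈xy P∈uv
  ... | no _ | yes refl | _ | _ =
    u , inj₁ refl , inj₂ refl ,
    atEnd u x P (orient-start (pos u) (pos v)) uv
      (λ { refl → loopless u xy }) (λ { refl → notSame (inj₂ (refl , refl)) })
      (onSegment-sym (pos x) (pos u) P P∈xy) P∈uv
  ... | no _ | no _ | yes refl | _ =
    v , inj₂ refl , inj₁ refl ,
    atEnd v y P (orient-end (pos u) (pos v)) uv
      (λ { refl → notSame (inj₂ (refl , refl)) }) (λ { refl → loopless v xy })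
      P∈xy P∈uv
  ... | no _ | no _ | no _ | yes refl =
    v , inj₂ refl , inj₂ refl ,
    atEnd v x P (orient-end (pos u) (pos v)) uv
      (λ { refl → notSame (inj₁ (refl , refl)) }) (λ { refl → loopless v xy })
      (onSegment-sym (pos x) (pos v) P P∈xy) P∈uv
  ... | no u≢x | no u≢y | no v≢x | no v≢y =
    ⊥-elim (separated⇒disjoint (pos u) (pos v) (pos x) (pos y) P
             (separated u v x y uv xy u≢x u≢y v≢x v≢y) P∈uv P∈xy)

_==_ : ∀ {n} → Fin n → Fin n → Bool
i == j = does (i ≟ᶠ j)

-- Dart i leaves tail i towards the (remainder 3 i)-th of the other three
-- vertices; this is also the order in which elems Gr lists the vertices.
tail : Fin 12 → Fin 4
tail = quotient 3

head : Fin 12 → Fin 4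
head i = punchIn (tail i) (remainder {4} 3 i)

Darts : Graph
Darts = finGraph 12 λ i j →
  not (i == j) ∧ (tail i == tail j ∨ (tail i == head j ∧ head i == tail j))

DartsSquare : Graph
DartsSquare = finGraph 12 λ i j →
  not (i == j) ∧ (tail i == tail j ∨ tail i == head j ∨ head i == tail j)

dart : Fin 12 → V Gr
dart = lookup (elems Gr)

-- Junk value 0F when a ≡ b.
dartIndex : Fin 4 → Fin 4 → Fin 12
dartIndex a b with a ≟ᶠ b
... | yes _  = 0F
... | no a≢b = combine a (punchOut a≢b)

-- An edge of S(K₄) joins a vertex a of K₄ to the subdivision vertex of an
-- edge u v at a, and is always listed in this order since S(K₄) orders
-- the old vertices first.
dartOf : V Gr → Fin 12
dartOf ((inj₁ a , inj₂ ((u , v) , _)) , _) = dartIndex a (if a == u then v else u)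
dartOf ((inj₁ _ , inj₁ _) , ())
dartOf ((inj₂ _ , inj₂ _) , ())
dartOf ((inj₂ _ , inj₁ _) , q) = ⊥-elim (subst T (Bool.∧-zeroʳ _) q)

endpoints : V Gr → Maybe (Fin 4 × Fin 4 × Fin 4)
endpoints ((inj₁ a , inj₂ ((u , v) , _)) , _) = just (a , u , v)
endpoints _                                   = nothing

endpoints-injective : ∀ w {a u v p q} → endpoints w ≡ just (a , u , v) →
                      w ≡ ((inj₁ a , inj₂ ((u , v) , p)) , q)
endpoints-injective ((inj₁ a , inj₂ ((u , v) , p)) , q) {p = p′} {q′} refl
  with refl ← Bool.T-irrelevant p p′
  = cong (_ ,_) (Bool.T-irrelevant q q′)

dart-dartOf-endpoints : ∀ a u v → T (adj K4 u v ∧ ltv K4 u v) → T (a == u ∨ a == v) →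
  endpoints (dart (dartIndex a (if a == u then v else u))) ≡ just (a , u , v)
dart-dartOf-endpoints = from-yes
  (all? λ a → all? λ u → all? λ v →
    T? (adj K4 u v ∧ ltv K4 u v) →-dec T? (a == u ∨ a == v) →-dec
    endpoints (dart (dartIndex a (if a == u then v else u))) ≟ just (a , u , v))
  where
  _≟_ : DecidableEquality (Maybe (Fin 4 × Fin 4 × Fin 4))
  _≟_ = Maybe.≡-dec (Product.≡-dec _≟ᶠ_ (Product.≡-dec _≟ᶠ_ _≟ᶠ_))

dart-dartOf : ∀ w → dart (dartOf w) ≡ w
dart-dartOf w@((inj₁ a , inj₂ ((u , v) , p)) , q) =
  endpoints-injective (dart (dartOf w))
    (dart-dartOf-endpoints a u v p (subst T (Bool.∧-identityʳ _) q))
dart-dartOf ((inj₁ _ , inj₁ _) , ())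
dart-dartOf ((inj₂ _ , inj₂ _) , ())
dart-dartOf ((inj₂ _ , inj₁ _) , q) = ⊥-elim (subst T (Bool.∧-zeroʳ _) q)

dartOf-dart : ∀ i → dartOf (dart i) ≡ i
dartOf-dart = from-yes (all? λ i → dartOf (dart i) ≟ᶠ i)

dart-bijection : Fin 12 ↔ V Gr
dart-bijection = mk↔ₛ′ dart dartOf dart-dartOf dartOf-dart

darts≅Gr : Darts ≅ Gr
darts≅Gr = record
  { vertices = dart-bijection
  ; adj-≡    = from-yes (all? λ i → all? λ j → adj Gr (dart i) (dart j) Bool.≟ adj Darts i j)
  }

dartsSquare≅SquareGr : DartsSquare ≅ Square Gr
dartsSquare≅SquareGr = record
  { vertices = dart-bijection
  ; adj-≡    = from-yes (all? λ i → all? λ j →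
      adj (Square Gr) (dart i) (dart j) Bool.≟ adj DartsSquare i j)
  }

darts-clawFree : ClawFree Darts
darts-clawFree = from-no (claw? (adj Darts))

darts-cubic : Cubic Darts
darts-cubic = from-yes (cubic? (adj Darts))

-- A straight-line drawing of K₄ with 0 near the centroid of the triangle 1 2 3.
corner : Fin 4 → ℤ × ℤ
corner 0F = + 1      , + 0
corner 1F = + 0      , + 12
corner 2F = ℤ.- + 11 , ℤ.- + 6
corner 3F = + 13     , ℤ.- + 5

-- Truncating the drawing of K₄ (scaled by 4): dart a → b sits a quarter of
-- the way from corner a to corner b, except that darts entering the inner
-- corner 0 sit halfway, so that each outer triangle of darts stays clear
-- of the edge towards 0.
dartPoint : Fin 12 → Point
dartPoint i = coordinate proj₁ , coordinate proj₂
  where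
  toHead : ℤ
  toHead = if head i == 0F then + 2 else + 1
  coordinate : (ℤ × ℤ → ℤ) → ℚ
  coordinate π = ((+ 4 ℤ.- toHead) ℤ.* π (corner (tail i)) ℤ.+ toHead ℤ.* π (corner (head i))) / 1

darts-certificate : DrawingCertificate Darts dartPoint
darts-certificate = record
  { injective       = from-yes (all? λ u → all? λ v →
      Product.≡-dec ℚ._≟_ ℚ._≟_ (dartPoint u) (dartPoint v) →-dec u ≟ᶠ v)
  ; loopless        = from-yes (all? λ u → ¬? (T? (adj Darts u u)))
  ; generalPosition = from-yes (all? λ u → all? λ v → all? λ w →
      T? (adj Darts u v) →-dec ¬? (w ≟ᶠ u) →-dec ¬? (w ≟ᶠ v) →-dec
      ¬? (orient (dartPoint u) (dartPoint v) (dartPoint w) ℚ.≟ 0ℚ))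
  ; separated       = from-yes (all? λ u → all? λ v → all? λ x → all? λ y →
      T? (adj Darts u v) →-dec T? (adj Darts x y) →-dec
      ¬? (u ≟ᶠ x) →-dec ¬? (u ≟ᶠ y) →-dec ¬? (v ≟ᶠ x) →-dec ¬? (v ≟ᶠ y) →-dec
      separated? (dartPoint u) (dartPoint v) (dartPoint x) (dartPoint y))
  }

head-proper : Proper DartsSquare head
head-proper = from-yes (all? λ u → all? λ v → T? (adj DartsSquare u v) →-dec ¬? (head u ≟ᶠ head v))

-- The darts 0 → 1, 0 → 2, 0 → 3 and 1 → 0.
clique : Fin 4 → Fin 12
clique i = i ↑ˡ 8

clique-adj : ∀ i j → i ≢ j → Adj DartsSquare (clique i) (clique j)
clique-adj = from-yes (all? λ i → all? λ j →
  ¬? (i ≟ᶠ j) →-dec T? (adj DartsSquare (clique i) (clique j)))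

dartsSquare-χ : IsChromaticNumber DartsSquare 4
dartsSquare-χ = isLeast-suc (colorable-mono DartsSquare)
  (clique⇒¬colorable DartsSquare clique clique-adj) (head , head-proper)

-- The perfect matchings of K₄ are {01, 23}, {02, 13} and {03, 12}; number
-- each by the partner of 0 in it.
perfectMatching : Fin 4 → Fin 4 → ℕ
perfectMatching 0F b  = toℕ b
perfectMatching a  0F = toℕ a
perfectMatching a  b  = 6 ℕ.∸ (toℕ a + toℕ b)

dartsSquare-¬mColorable5 : ¬ MColorable DartsSquare 5
dartsSquare-¬mColorable5 = refuted⇒¬mColorable (allFin 12) (from-yes (refuted? (allFin 12) []))
  where
  forbidden : Fin 12 → ℤ
  forbidden i = + perfectMatching (tail i) (head i)
  open Backtracking DartsSquare 5 forbidden

-- A class colour has to avoid at most two earlier class colours and the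
-- three forbidden values in its class, a dart entering 3 the three class
-- colours and its own forbidden value: fewer than 6 values in each case.
module AvoidingColouring (c₀ : Fin 12 → ℤ) where

  entering : Fin 4 → List (Fin 12)
  entering b = filter (λ i → head i ≟ᶠ b) (allFin 12)

  ∈-entering : ∀ i → i ∈ entering (head i)
  ∈-entering i = ∈-filter⁺ (λ j → head j ≟ᶠ head i) (∈-allFin i) refl

  forbiddenOn : Fin 4 → List ℤ
  forbiddenOn b = map c₀ (entering b)

  Avoiding : List ℤ → Set
  Avoiding xs = Σ (Fin 6) λ c → All (label c ≢_) xs

  fresh₆ : (xs : List ℤ) → {True (length xs ℕ.<? 6)} → Avoiding xs
  fresh₆ xs {xs<6} = fresh xs (toWitness xs<6)

  class₀ : Avoiding (forbiddenOn 0F)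
  class₀ = fresh₆ _

  class₁ : Avoiding (label (proj₁ class₀) ∷ forbiddenOn 1F)
  class₁ = fresh₆ _

  class₂ : Avoiding (label (proj₁ class₀) ∷ label (proj₁ class₁) ∷ forbiddenOn 2F)
  class₂ = fresh₆ _

  class₃ : ∀ v →
    Avoiding (label (proj₁ class₀) ∷ label (proj₁ class₁) ∷ label (proj₁ class₂) ∷ c₀ v ∷ [])
  class₃ v = fresh₆ _

  classColour : Fin 4 → Fin 12 → Fin 6
  classColour 0F _ = proj₁ class₀
  classColour 1F _ = proj₁ class₁
  classColour 2F _ = proj₁ class₂
  classColour 3F v = proj₁ (class₃ v)

  avoids-forbidden : ∀ b v → v ∈ entering b → label (classColour b v) ≢ c₀ v
  avoids-forbidden 0F v v∈ = All.lookup (proj₂ class₀) (∈-map⁺ c₀ v∈)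
  avoids-forbidden 1F v v∈ = All.lookup (proj₂ class₁) (there (∈-map⁺ c₀ v∈))
  avoids-forbidden 2F v v∈ = All.lookup (proj₂ class₂) (there (there (∈-map⁺ c₀ v∈)))
  avoids-forbidden 3F v _  = All.lookup (proj₂ (class₃ v)) (there (there (there (here refl))))

  class₁≢class₀ : proj₁ class₁ ≢ proj₁ class₀
  class₁≢class₀ = differ (All.lookup (proj₂ class₁) (here refl))

  class₂≢class₀ : proj₁ class₂ ≢ proj₁ class₀
  class₂≢class₀ = differ (All.lookup (proj₂ class₂) (here refl))

  class₂≢class₁ : proj₁ class₂ ≢ proj₁ class₁
  class₂≢class₁ = differ (All.lookup (proj₂ class₂) (there (here refl)))

  class₃≢class₀ : ∀ v → proj₁ (class₃ v) ≢ proj₁ class₀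
  class₃≢class₀ v = differ (All.lookup (proj₂ (class₃ v)) (here refl))

  class₃≢class₁ : ∀ v → proj₁ (class₃ v) ≢ proj₁ class₁
  class₃≢class₁ v = differ (All.lookup (proj₂ (class₃ v)) (there (here refl)))

  class₃≢class₂ : ∀ v → proj₁ (class₃ v) ≢ proj₁ class₂
  class₃≢class₂ v = differ (All.lookup (proj₂ (class₃ v)) (there (there (here refl))))

  classColour-distinct : ∀ b b′ v w → b ≢ b′ → classColour b v ≢ classColour b′ w
  classColour-distinct 0F 0F _ _ 0≢0 = contradiction refl 0≢0
  classColour-distinct 1F 1F _ _ 1≢1 = contradiction refl 1≢1
  classColour-distinct 2F 2F _ _ 2≢2 = contradiction refl 2≢2
  classColour-distinct 3F 3F _ _ 3≢3 = contradiction refl 3≢3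
  classColour-distinct 1F 0F _ _ _ = class₁≢class₀
  classColour-distinct 2F 0F _ _ _ = class₂≢class₀
  classColour-distinct 2F 1F _ _ _ = class₂≢class₁
  classColour-distinct 3F 0F v _ _ = class₃≢class₀ v
  classColour-distinct 3F 1F v _ _ = class₃≢class₁ v
  classColour-distinct 3F 2F v _ _ = class₃≢class₂ v
  classColour-distinct 0F 1F _ _ _ = ≢-sym class₁≢class₀
  classColour-distinct 0F 2F _ _ _ = ≢-sym class₂≢class₀
  classColour-distinct 1F 2F _ _ _ = ≢-sym class₂≢class₁
  classColour-distinct 0F 3F _ w _ = ≢-sym (class₃≢class₀ w)
  classColour-distinct 1F 3F _ w _ = ≢-sym (class₃≢class₁ w)
  classColour-distinct 2F 3F _ w _ = ≢-sym (class₃≢class₂ w)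

  colour : Fin 12 → Fin 6
  colour v = classColour (head v) v

  colour-proper : Proper DartsSquare colour
  colour-proper u v uv = classColour-distinct (head u) (head v) u v (head-proper u v uv)

  colour-avoids : ∀ v → label (colour v) ≢ c₀ v
  colour-avoids v = avoids-forbidden (head v) v (∈-entering v)

dartsSquare-mColorable6 : MColorable DartsSquare 6
dartsSquare-mColorable6 c₀ = colour , colour-proper , colour-avoids
  where open AvoidingColouring c₀

dartsSquare-χM : IsMirzakhaniChromaticNumber DartsSquare 6
dartsSquare-χM =
  isLeast-suc (mColorable-mono DartsSquare) dartsSquare-¬mColorable5 dartsSquare-mColorable6

mainTheorem3 : ClawFree Gr × Planar Gr × Cubic Gr × HasOrder Gr 12 ×
    Σ ℕ (λ a → Σ ℕ (λ b → IsChromaticNumber (Square Gr) a ×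
      IsMirzakhaniChromaticNumber (Square Gr) b × a + 1 < b))
mainTheorem3 =
  clawFree-≅ darts≅Gr darts-clawFree ,
  planar-≅ darts≅Gr (certificate⇒drawing _≟ᶠ_ darts-certificate) ,
  cubic-≅ darts≅Gr darts-cubic ,
  ↔-sym dart-bijection ,
  4 , 6 ,
  isChromaticNumber-≅ dartsSquare≅SquareGr dartsSquare-χ ,
  isMirzakhaniChromaticNumber-≅ dartsSquare≅SquareGr dartsSquare-χM ,
  ℕ.n<1+n 5
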